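{- For any injective word $W=a_1\cdots a_r$ in the alphabet $\overline{\mathbb{P}}$ (all letters distinct), the polynomial $\mathfrak{F}(W)$ is either zero or equal to the slide polynomial $\mathfrak{F}_{\mathbf c}$ for a unique weak composition $\mathbf c$ (a sequence of nonnegative integers $(c_1,c_2,\dots)$ indexed by positive integers with finite support).
   Context: $\overline{\mathbb{P}}$ is the totally ordered alphabet of symbols $i_j$ with $i,j\in\mathbb{Z}_{>0}$, ordered lexicographically ($i_j<i'_{j'}$ iff $i<i'$, or $i=i'$ and $j<j'$), with $\mathrm{val}(i_j)=i$. For an injective word $W=a_1\cdots a_r$ in $\overline{\mathbb{P}}$, \[ \mathfrak{F}(W)=\sum x_{i_1}x_{i_2}\cdots x_{i_r}\in\mathbb{Q}[x_1,x_2,\dots], \] summed over integers $i_1\ge i_2\ge\cdots\ge i_r>0$ with $i_j>i_{j+1}$ whenever $a_j>a_{j+1}$, and $i_j\le\mathrm{val}(a_j)$ for all $j$. For a weak composition $\mathbf c$, $W_{\mathbf c}$ is the word consisting of the letters $i_j$ with $c_i>0$ and $1\le j\le c_i$, arranged with $i$ decreasing and, for fixed $i$, $j$ increasing; the slide polynomial is $\mathfrak{F}_{\mathbf c}=\mathfrak{F}(W_{\mathbf c})$. -}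

module Defs where

open import Data.Nat using (ℕ; zero; suc; _<ᵇ_; _≤ᵇ_; _≡ᵇ_)
open import Data.Bool using (Bool; true; false; _∧_; _∨_; not)
open import Data.Product using (_×_; _,_; proj₁)
open import Data.List using (List; []; _∷_; _++_; map; concatMap; filterᵇ; upTo)
open import Data.List.Relation.Unary.All using (All)
import Data.List.Relation.Binary.Permutation.Propositional as PermP
import Data.List.Relation.Binary.Permutation.Setoid as PermS
open import Relation.Binary.PropositionalEquality using (_≡_)

-- The alphabet P̄ : letters i_j encoded as pairs (i , j), i j > 0.

Letter : Set
Letter = ℕ × ℕ

val : Letter → ℕ
val = proj₁

PositiveLetter : Letter → Set
PositiveLetter (i , j) = (0 Data.Nat.< i) × (0 Data.Nat.< j)

_<L_ : Letter → Letter → Bool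
(i , j) <L (i' , j') = (i <ᵇ i') ∨ ((i ≡ᵇ i') ∧ (j <ᵇ j'))

Word : Set
Word = List Letter

-- Polynomials with nonnegative integer coefficients in x₁, x₂, …
-- A monomial x_{i₁} ⋯ x_{i_r} is the list of its variable indices,
-- considered up to permutation (commutativity); a polynomial is a
-- formal sum (list) of monomials, considered up to permutation of the
-- summands.  Since all coefficients are nonnegative, two such sums are
-- equal in ℚ[x₁,x₂,…] iff they are related by _≈P_ below.

Monomial : Set
Monomial = List ℕ

Poly : Set
Poly = List Monomial

_≈P_ : Poly → Poly → Set
P ≈P Q = PermS._↭_ (PermP.↭-setoid {A = ℕ}) P Q

0P : Poly
0P = []

range1 : ℕ → List ℕ
range1 k = map suc (upTo k)

candidates : Word → List (List ℕ)
candidates []      = [] ∷ []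
candidates (a ∷ W) = concatMap (λ i → map (i ∷_) (candidates W)) (range1 (val a))

admissible : Word → List ℕ → Bool
admissible (a ∷ b ∷ W) (i ∷ i' ∷ is) =
  (i' ≤ᵇ i) ∧ (not (b <L a) ∨ (i' <ᵇ i)) ∧ admissible (b ∷ W) (i' ∷ is)
admissible _ _ = true

𝔉 : Word → Poly
𝔉 W = filterᵇ (admissible W) (candidates W)

-- Weak compositions: finite lists (c₁, c₂, …, c_n), understood as
-- padded with zeros; two lists are the same weak composition iff
-- they agree at every positive index (with default 0).

WeakComp : Set
WeakComp = List ℕ

-- c_i (1-indexed, 0 beyond the list)
_at_ : WeakComp → ℕ → ℕ
c        at zero          = 0
[]       at suc i         = 0
(k ∷ ks) at suc zero      = k
(k ∷ ks) at suc (suc i)   = ks at suc i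

_≈C_ : WeakComp → WeakComp → Set
c ≈C c' = ∀ i → c at i ≡ c' at i

-- W_c : letters i_j (c_i > 0, 1 ≤ j ≤ c_i), i decreasing, j increasing
block : ℕ → ℕ → Word
block i k = map (λ j → (i , j)) (range1 k)

wordFrom : ℕ → WeakComp → Word
wordFrom i []       = []
wordFrom i (k ∷ ks) = wordFrom (suc i) ks ++ block i k

W[_] : WeakComp → Word
W[ c ] = wordFrom 1 c

slide : WeakComp → Poly
slide c = 𝔉 W[ c ]

-- 𝔉(W) only depends on the values of the letters of W and on where W has descents. Since an
-- index after a descent is at most the previous index minus one, and otherwise at most the
-- previous index, the bound val(a_j) can be replaced by b_j := min(val(a_j), b_{j-1} - [descent])
-- without changing the set of index sequences. If some b_j is 0 there is no sequence at all;
-- otherwise b_1 ≥ b_2 ≥ ⋯ ≥ 1, a descent of W sits exactly where b_j > b_{j+1}, and these are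
-- precisely the values and descents of W_c with c_i = #{j | b_j = i}. For uniqueness, the sequence
-- of values of W_c is itself a term of 𝔉_c dominating all others entrywise, so 𝔉_c determines the
-- multiset of values of W_c, and hence c.
module Submission where

open import Defs
open import Data.Bool using (Bool; true; false; T; not; _∧_; _∨_; if_then_else_)
open import Data.Bool.Properties using (∧-assoc; ∧-zeroʳ; ∧-identityʳ; T-≡)
open import Data.Empty using (⊥-elim)
open import Data.List
  using (List; []; _∷_; _++_; _∷ʳ_; map; concat; concatMap; filter; filterᵇ; length; replicate; upTo)
open import Data.List.Properties
  using ( filter-++; filter-all; filter-none; length-replicate; length-++; length-map; length-upTo
        ; map-∘; map-++; map-upTo; map-cong-local; concatMap-cong; ++-assoc; ++-identityʳ)
open import Data.List.Membership.Propositional using (_∈_; lose; find)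
open import Data.List.Membership.Propositional.Properties using (∈-map⁺; ∈-upTo⁺; ∈-concatMap⁺; ∈-filter⁺)
open import Data.List.Relation.Binary.Permutation.Propositional using (_↭_; ↭-reflexive; ↭-setoid)
open import Data.List.Relation.Binary.Permutation.Propositional.Properties using (↭-length; filter-↭)
open import Data.List.Relation.Binary.Pointwise using (Pointwise; []; _∷_)
open import Data.List.Relation.Unary.All as All using (All; []; _∷_)
import Data.List.Relation.Unary.All.Properties as AllP
open import Data.List.Relation.Unary.AllPairs as AllPairs using (AllPairs; []; _∷_)
import Data.List.Relation.Unary.AllPairs.Properties as AllPairsP
open import Data.List.Relation.Unary.Any as Any using (Any; here; there)
open import Data.List.Relation.Unary.Linked using (Linked; []; [-]; _∷_)
import Data.List.Relation.Unary.Linked.Properties as LinkedP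
open import Data.List.Relation.Unary.Unique.Propositional using (Unique)
open import Data.Nat
  using (ℕ; zero; suc; _+_; _∸_; _⊓_; _≟_; _≤_; _<_; _≥_; _<ᵇ_; _≤ᵇ_; _≡ᵇ_; s≤s; z≤n)
open import Data.Nat.ListAction using (sum)
open import Data.Nat.ListAction.Properties using (sum-↭)
open import Data.Nat.Properties
open import Data.Product using (Σ; _×_; _,_; proj₁; proj₂; map₁)
open import Data.Sum using (_⊎_; inj₁; inj₂)
open import Function using (_∘_; id; Equivalence)
open import Relation.Binary.PropositionalEquality
open import Relation.Nullary.Decidable using (T?)

open import Data.List.Relation.Binary.Permutation.Setoid (↭-setoid {A = ℕ})
  using () renaming (↭-sym to ≈P-sym; ↭-trans to ≈P-trans; ↭-reflexive to ≈P-reflexive)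
open import Data.List.Relation.Binary.Permutation.Setoid.Properties (↭-setoid {A = ℕ})
  using () renaming (∈-resp-↭ to ∈-resp-≈P)

private variable A B : Set

filterᵇ-map : (p : B → Bool) (g : A → B) (xs : List A) →
              filterᵇ p (map g xs) ≡ map g (filterᵇ (p ∘ g) xs)
filterᵇ-map p g []       = refl
filterᵇ-map p g (x ∷ xs) with p (g x)
... | true  = cong (g x ∷_) (filterᵇ-map p g xs)
... | false = filterᵇ-map p g xs

filterᵇ-cong : {p q : A → Bool} → (∀ x → p x ≡ q x) → ∀ xs → filterᵇ p xs ≡ filterᵇ q xs
filterᵇ-cong p≗q [] = refl
filterᵇ-cong {p = p} {q} p≗q (x ∷ xs) with p x | q x | p≗q x
... | true  | true  | _ = cong (x ∷_) (filterᵇ-cong p≗q xs)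
... | false | false | _ = filterᵇ-cong p≗q xs

filterᵇ-const : (b : Bool) (xs : List A) → filterᵇ (λ _ → b) xs ≡ (if b then xs else [])
filterᵇ-const true  []       = refl
filterᵇ-const true  (x ∷ xs) = cong (x ∷_) (filterᵇ-const true xs)
filterᵇ-const false []       = refl
filterᵇ-const false (x ∷ xs) = filterᵇ-const false xs

filterᵇ-∧ : (q r : A → Bool) (xs : List A) →
            filterᵇ (λ x → q x ∧ r x) xs ≡ filterᵇ q (filterᵇ r xs)
filterᵇ-∧ q r [] = refl
filterᵇ-∧ q r (x ∷ xs) with r x
... | false rewrite ∧-zeroʳ (q x) = filterᵇ-∧ q r xs
... | true  rewrite ∧-identityʳ (q x) with q x
...   | true  = cong (x ∷_) (filterᵇ-∧ q r xs)
...   | false = filterᵇ-∧ q r xs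

filterᵇ-concatMap : (p : B → Bool) (f : A → List B) (xs : List A) →
                    filterᵇ p (concatMap f xs) ≡ concatMap (filterᵇ p ∘ f) xs
filterᵇ-concatMap p f []       = refl
filterᵇ-concatMap p f (x ∷ xs) =
  trans (filter-++ (T? ∘ p) (f x) (concatMap f xs))
        (cong (filterᵇ p (f x) ++_) (filterᵇ-concatMap p f xs))

concatMap-[] : (xs : List A) → concatMap {B = B} (λ _ → []) xs ≡ []
concatMap-[] []       = refl
concatMap-[] (x ∷ xs) = concatMap-[] xs

headSatisfies : (ℕ → Bool) → List ℕ → Bool
headSatisfies q []      = true
headSatisfies q (i ∷ _) = q i

filterᵇ-headSatisfies : (q : ℕ → Bool) (Y : ℕ → List (List ℕ)) (xs : List ℕ) →
  filterᵇ (headSatisfies q) (concatMap (λ i → map (i ∷_) (Y i)) xs) ≡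
  concatMap (λ i → map (i ∷_) (Y i)) (filterᵇ q xs)
filterᵇ-headSatisfies q Y [] = refl
filterᵇ-headSatisfies q Y (x ∷ xs)
  rewrite filter-++ (T? ∘ headSatisfies q) (map (x ∷_) (Y x)) (concatMap (λ i → map (i ∷_) (Y i)) xs)
        | filterᵇ-map (headSatisfies q) (x ∷_) (Y x)
        | filterᵇ-headSatisfies q Y xs
  with q x
... | true  = cong (λ ys → map (x ∷_) ys ++ _) (filterᵇ-const true (Y x))
... | false = cong (λ ys → map (x ∷_) ys ++ _) (filterᵇ-const false (Y x))

range1-suc : (n : ℕ) → range1 (suc n) ≡ 1 ∷ map suc (range1 n)
range1-suc n = cong (λ l → 1 ∷ map suc l) (sym (map-upTo suc n))

range1-all : {P : ℕ → Set} (n : ℕ) → (∀ {j} → j < n → P (suc j)) → All P (range1 n)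
range1-all n p = AllP.map⁺ (AllP.applyUpTo⁺₁ id n p)

suc∈range1 : (n : ℕ) → suc n ∈ range1 (suc n)
suc∈range1 n = ∈-map⁺ suc (∈-upTo⁺ ≤-refl)

suc-≤ᵇ-suc : (m n : ℕ) → (suc m ≤ᵇ suc n) ≡ (m ≤ᵇ n)
suc-≤ᵇ-suc zero    n = refl
suc-≤ᵇ-suc (suc m) n = refl

filterᵇ-≤-range1 : (n k : ℕ) → filterᵇ (_≤ᵇ k) (range1 n) ≡ range1 (n ⊓ k)
filterᵇ-≤-range1 zero    k    = refl
filterᵇ-≤-range1 (suc n) zero = begin
  filterᵇ (_≤ᵇ 0) (range1 (suc n))           ≡⟨ cong (filterᵇ (_≤ᵇ 0)) (range1-suc n) ⟩
  filterᵇ (_≤ᵇ 0) (map suc (range1 n))       ≡⟨ filterᵇ-map (_≤ᵇ 0) suc (range1 n) ⟩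
  map suc (filterᵇ (λ _ → false) (range1 n)) ≡⟨ cong (map suc) (filterᵇ-const false (range1 n)) ⟩
  []                                         ∎
  where open ≡-Reasoning
filterᵇ-≤-range1 (suc n) (suc k) = begin
  filterᵇ (_≤ᵇ suc k) (range1 (suc n))
    ≡⟨ cong (filterᵇ (_≤ᵇ suc k)) (range1-suc n) ⟩
  1 ∷ filterᵇ (_≤ᵇ suc k) (map suc (range1 n))
    ≡⟨ cong (1 ∷_) (filterᵇ-map (_≤ᵇ suc k) suc (range1 n)) ⟩
  1 ∷ map suc (filterᵇ (λ m → suc m ≤ᵇ suc k) (range1 n))
    ≡⟨ cong (λ l → 1 ∷ map suc l) (filterᵇ-cong (λ m → suc-≤ᵇ-suc m k) (range1 n)) ⟩
  1 ∷ map suc (filterᵇ (_≤ᵇ k) (range1 n))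
    ≡⟨ cong (λ l → 1 ∷ map suc l) (filterᵇ-≤-range1 n k) ⟩
  1 ∷ map suc (range1 (n ⊓ k))
    ≡⟨ range1-suc (n ⊓ k) ⟨
  range1 (suc n ⊓ suc k) ∎
  where open ≡-Reasoning

<⇒<ᵇ≡true : {m n : ℕ} → m < n → (m <ᵇ n) ≡ true
<⇒<ᵇ≡true m<n = Equivalence.to T-≡ (<⇒<ᵇ m<n)

≥⇒<ᵇ≡false : {m n : ℕ} → n ≤ m → (m <ᵇ n) ≡ false
≥⇒<ᵇ≡false {m} {n} n≤m with m <ᵇ n in eq
... | false = refl
... | true  = ⊥-elim (<⇒≱ (<ᵇ⇒< m n (Equivalence.from T-≡ eq)) n≤m)

<ᵇ≡false⇒≥ : (m n : ℕ) → (m <ᵇ n) ≡ false → n ≤ m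
<ᵇ≡false⇒≥ m n eq = ≮⇒≥ (λ m<n → subst T eq (<⇒<ᵇ m<n))

-- Index sequences for 𝔉

step : Bool → ℕ → ℕ → Bool
step d i i′ = (i′ ≤ᵇ i) ∧ (not d ∨ (i′ <ᵇ i))

descent : Letter → Word → Bool
descent a []      = false
descent a (b ∷ _) = b <L a

Shape : Set
Shape = List (ℕ × Bool)

shape : Word → Shape
shape []      = []
shape (a ∷ W) = (val a , descent a W) ∷ shape W

values : Shape → List ℕ
values = map proj₁

prefixed : Bool → List (List ℕ) → ℕ → List (List ℕ)
prefixed d X i = map (i ∷_) (filterᵇ (headSatisfies (step d i)) X)

sequences : Shape → List (List ℕ)
sequences []            = [] ∷ []
sequences ((v , d) ∷ s) = concatMap (prefixed d (sequences s)) (range1 v)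

admissible-[] : (W : Word) → admissible W [] ≡ true
admissible-[] []          = refl
admissible-[] (_ ∷ [])    = refl
admissible-[] (_ ∷ _ ∷ _) = refl

filterᵇ-admissible-∷ : (a : Letter) (W : Word) (i : ℕ) →
  filterᵇ (λ is → admissible (a ∷ W) (i ∷ is)) (candidates W) ≡
  filterᵇ (headSatisfies (step (descent a W) i)) (𝔉 W)
filterᵇ-admissible-∷ a []      i = refl
filterᵇ-admissible-∷ a (b ∷ W) i =
  trans (filterᵇ-cong split (candidates (b ∷ W)))
        (filterᵇ-∧ _ (admissible (b ∷ W)) (candidates (b ∷ W)))
  where
  split : ∀ is → admissible (a ∷ b ∷ W) (i ∷ is) ≡
                 headSatisfies (step (b <L a) i) is ∧ admissible (b ∷ W) is
  split []        = sym (admissible-[] (b ∷ W))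
  split (i′ ∷ is) = sym (∧-assoc (i′ ≤ᵇ i) _ _)

𝔉≡sequences : (W : Word) → 𝔉 W ≡ sequences (shape W)
𝔉≡sequences []      = refl
𝔉≡sequences (a ∷ W) = begin
  filterᵇ (admissible (a ∷ W)) (concatMap (λ i → map (i ∷_) (candidates W)) (range1 (val a)))
    ≡⟨ filterᵇ-concatMap (admissible (a ∷ W)) _ (range1 (val a)) ⟩
  concatMap (λ i → filterᵇ (admissible (a ∷ W)) (map (i ∷_) (candidates W))) (range1 (val a))
    ≡⟨ concatMap-cong restrict (range1 (val a)) ⟩
  concatMap (prefixed (descent a W) (𝔉 W)) (range1 (val a))
    ≡⟨ cong (λ X → concatMap (prefixed (descent a W) X) (range1 (val a))) (𝔉≡sequences W) ⟩
  sequences (shape (a ∷ W)) ∎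
  where
  open ≡-Reasoning
  restrict : ∀ i → filterᵇ (admissible (a ∷ W)) (map (i ∷_) (candidates W)) ≡
                   prefixed (descent a W) (𝔉 W) i
  restrict i = trans (filterᵇ-map (admissible (a ∷ W)) (i ∷_) (candidates W))
                     (cong (map (i ∷_)) (filterᵇ-admissible-∷ a W i))

-- Capping the values of a shape

indicator : Bool → ℕ
indicator true  = 1
indicator false = 0

<ᵇ-suc-∧ : (j k : ℕ) → (j <ᵇ suc k) ∧ (j <ᵇ k) ≡ (j <ᵇ k)
<ᵇ-suc-∧ j       zero    = ∧-zeroʳ (j <ᵇ 1)
<ᵇ-suc-∧ zero    (suc k) = refl
<ᵇ-suc-∧ (suc j) (suc k) = <ᵇ-suc-∧ j k

step-suc : (d : Bool) (i i′ : ℕ) → step d (suc i) i′ ≡ (i′ ≤ᵇ suc i ∸ indicator d)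
step-suc false i i′       = ∧-identityʳ _
step-suc true  i zero     = refl
step-suc true  i (suc i′) = <ᵇ-suc-∧ i′ i

filterᵇ-step-sequences : (d : Bool) (i v : ℕ) (e : Bool) (s : Shape) →
  filterᵇ (headSatisfies (step d (suc i))) (sequences ((v , e) ∷ s)) ≡
  sequences ((v ⊓ (suc i ∸ indicator d) , e) ∷ s)
filterᵇ-step-sequences d i v e s = begin
  filterᵇ (headSatisfies (step d (suc i))) (concatMap G (range1 v))
    ≡⟨ filterᵇ-cong step-bound (concatMap G (range1 v)) ⟩
  filterᵇ (headSatisfies (_≤ᵇ bound)) (concatMap G (range1 v))
    ≡⟨ filterᵇ-headSatisfies (_≤ᵇ bound) _ (range1 v) ⟩
  concatMap G (filterᵇ (_≤ᵇ bound) (range1 v))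
    ≡⟨ cong (concatMap G) (filterᵇ-≤-range1 v bound) ⟩
  concatMap G (range1 (v ⊓ bound)) ∎
  where
  open ≡-Reasoning
  bound = suc i ∸ indicator d
  G = prefixed e (sequences s)
  step-bound : ∀ is → headSatisfies (step d (suc i)) is ≡ headSatisfies (_≤ᵇ bound) is
  step-bound []       = refl
  step-bound (i′ ∷ _) = step-suc d i i′

capHead : ℕ → Shape → Shape
capHead m []            = []
capHead m ((v , d) ∷ s) = (v ⊓ m , d) ∷ s

-- Caps every value by the largest index that the chain conditions allow at that position.
normalise : ℕ → Shape → Shape
normalise m []            = []
normalise m ((v , d) ∷ s) = (v ⊓ m , d) ∷ normalise (v ⊓ m ∸ indicator d) s

filterᵇ-step-capHead : (d : Bool) (i m : ℕ) → suc i ∸ indicator d ≤ m → (s : Shape) →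
  filterᵇ (headSatisfies (step d (suc i))) (sequences s) ≡
  filterᵇ (headSatisfies (step d (suc i))) (sequences (capHead m s))
filterᵇ-step-capHead d i m b≤m []            = refl
filterᵇ-step-capHead d i m b≤m ((v , e) ∷ s) = begin
  filterᵇ (headSatisfies (step d (suc i))) (sequences ((v , e) ∷ s))
    ≡⟨ filterᵇ-step-sequences d i v e s ⟩
  sequences ((v ⊓ b , e) ∷ s)
    ≡⟨ cong (λ x → sequences ((x , e) ∷ s)) v⊓b≡v⊓m⊓b ⟩
  sequences ((v ⊓ m ⊓ b , e) ∷ s)
    ≡⟨ filterᵇ-step-sequences d i (v ⊓ m) e s ⟨
  filterᵇ (headSatisfies (step d (suc i))) (sequences ((v ⊓ m , e) ∷ s)) ∎
  where
  open ≡-Reasoning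
  b = suc i ∸ indicator d
  v⊓b≡v⊓m⊓b : v ⊓ b ≡ v ⊓ m ⊓ b
  v⊓b≡v⊓m⊓b = trans (cong (v ⊓_) (sym (m≥n⇒m⊓n≡n b≤m))) (sym (⊓-assoc v m b))

sequences-capHead : (m : ℕ) (s : Shape) → sequences (capHead m s) ≡ sequences (normalise m s)
sequences-capHead m []            = refl
sequences-capHead m ((v , d) ∷ s) = cong concat (map-cong-local (range1-all (v ⊓ m) same))
  where
  m′ = v ⊓ m ∸ indicator d
  same : ∀ {i} → i < v ⊓ m →
         prefixed d (sequences s) (suc i) ≡ prefixed d (sequences (normalise m′ s)) (suc i)
  same {i} i<v⊓m = cong (map (suc i ∷_))
    (trans (filterᵇ-step-capHead d i m′ (∸-monoˡ-≤ (indicator d) i<v⊓m) s)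
           (cong (filterᵇ (headSatisfies (step d (suc i)))) (sequences-capHead m′ s)))

sequences-vanish : (s : Shape) → Any ((_≡ 0) ∘ proj₁) s → sequences s ≡ []
sequences-vanish ((.0 , d) ∷ s) (here refl) = refl
sequences-vanish ((v  , d) ∷ s) (there z) rewrite sequences-vanish s z = concatMap-[] (range1 v)

positive-or-vanishing : (s : Shape) → All ((0 <_) ∘ proj₁) s ⊎ Any ((_≡ 0) ∘ proj₁) s
positive-or-vanishing []                = inj₁ []
positive-or-vanishing ((zero  , d) ∷ s) = inj₂ (here refl)
positive-or-vanishing ((suc v , d) ∷ s) with positive-or-vanishing s
... | inj₁ pos = inj₁ (s≤s z≤n ∷ pos)
... | inj₂ z   = inj₂ (there z)

-- Descents exactly at the strict drops of value: the shape of W_c, whose values weakly decrease.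
canonShape : List ℕ → Shape
canonShape []          = []
canonShape (x ∷ [])    = (x , false) ∷ []
canonShape (x ∷ y ∷ l) = (x , (y <ᵇ x)) ∷ canonShape (y ∷ l)

values-canonShape : (l : List ℕ) → values (canonShape l) ≡ l
values-canonShape []          = refl
values-canonShape (x ∷ [])    = refl
values-canonShape (x ∷ y ∷ l) = cong (x ∷_) (values-canonShape (y ∷ l))

normalise-canonShape : (m : ℕ) (W : Word) → All ((0 <_) ∘ proj₁) (normalise m (shape W)) →
  normalise m (shape W) ≡ canonShape (values (normalise m (shape W)))
normalise-canonShape m []          _ = refl
normalise-canonShape m (a ∷ [])    _ = refl
normalise-canonShape m (a ∷ b ∷ W) (_ ∷ 0<y ∷ pos) =
  cong₂ (λ d s → (x , d) ∷ s) (descent≡drop (b <L a) refl)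
        (normalise-canonShape x′ (b ∷ W) (0<y ∷ pos))
  where
  x  = val a ⊓ m
  x′ = x ∸ indicator (b <L a)
  y  = val b ⊓ x′
  y≤x′ : y ≤ x′
  y≤x′ = m⊓n≤n (val b) x′
  descent≡drop : (d : Bool) → (b <L a) ≡ d → (b <L a) ≡ (y <ᵇ x)
  descent≡drop true  eq = trans eq (sym (<⇒<ᵇ≡true (y<x x (subst (λ d → y ≤ x ∸ indicator d) eq y≤x′))))
    where
    y<x : ∀ x → y ≤ x ∸ 1 → y < x
    y<x zero    y≤0 = ⊥-elim (<⇒≱ 0<y y≤0)
    y<x (suc x) y≤x = s≤s y≤x
  descent≡drop false eq = trans eq (sym (trans (cong (_<ᵇ x) y≡x) (≥⇒<ᵇ≡false {x} ≤-refl)))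
    where
    ∨-false : ∀ {p q} → (p ∨ q) ≡ false → p ≡ false
    ∨-false {false} _ = refl
    y≡x : y ≡ x
    y≡x = trans (cong (λ d → val b ⊓ (x ∸ indicator d)) eq)
                (m≥n⇒m⊓n≡n (≤-trans (m⊓n≤m (val a) m) (<ᵇ≡false⇒≥ (val b) (val a) (∨-false eq))))

normalise-decreasing : (m : ℕ) (s : Shape) → Linked _≥_ (values (normalise m s))
normalise-decreasing m []                      = []
normalise-decreasing m ((v , d) ∷ [])          = [-]
normalise-decreasing m ((v , d) ∷ (w , e) ∷ s) =
  ≤-trans (m⊓n≤n w _) (m∸n≤m (v ⊓ m) (indicator d)) ∷
  normalise-decreasing (v ⊓ m ∸ indicator d) ((w , e) ∷ s)

normalise-bounded : (m : ℕ) (s : Shape) → All (_≤ m) (values (normalise m s))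
normalise-bounded m []            = []
normalise-bounded m ((v , d) ∷ s) =
  m⊓n≤n v m ∷ All.map (λ le → ≤-trans le (≤-trans (m∸n≤m (v ⊓ m) (indicator d)) (m⊓n≤n v m)))
                      (normalise-bounded (v ⊓ m ∸ indicator d) s)

-- The words W_c

-- The order in which W_c lists its letters.
Precedes : Letter → Letter → Set
Precedes a b = val b < val a ⊎ (val a ≡ val b × proj₂ a < proj₂ b)

wordFrom-≥ : (k : ℕ) (c : WeakComp) → All ((k ≤_) ∘ val) (wordFrom k c)
wordFrom-≥ k []       = []
wordFrom-≥ k (x ∷ cs) =
  AllP.++⁺ (All.map (≤-trans (n≤1+n k)) (wordFrom-≥ (suc k) cs))
           (AllP.map⁺ (All.universal (λ _ → ≤-refl) (range1 x)))

block-sorted : (k x : ℕ) → AllPairs Precedes (block k x)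
block-sorted k x =
  AllPairsP.map⁺ (AllPairsP.map⁺ (AllPairsP.applyUpTo⁺₁ id x (λ i<j _ → inj₂ (refl , s≤s i<j))))

wordFrom-sorted : (k : ℕ) (c : WeakComp) → AllPairs Precedes (wordFrom k c)
wordFrom-sorted k []       = []
wordFrom-sorted k (x ∷ cs) =
  AllPairsP.++⁺ (wordFrom-sorted (suc k) cs) (block-sorted k x)
    (All.map (λ k<a → AllP.map⁺ (All.universal (λ _ → inj₁ k<a) (range1 x))) (wordFrom-≥ (suc k) cs))

descent-Precedes : (a b : Letter) → Precedes a b → (b <L a) ≡ (val b <ᵇ val a)
descent-Precedes (i , j) (i′ , j′) (inj₁ i′<i) rewrite <⇒<ᵇ≡true i′<i = refl
descent-Precedes (i , j) (.i , j′) (inj₂ (refl , j<j′))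
  rewrite ≥⇒<ᵇ≡false {i} ≤-refl | Equivalence.to T-≡ (≡⇒≡ᵇ i i refl) | ≥⇒<ᵇ≡false (<⇒≤ j<j′) = refl

shape-sorted : (W : Word) → Linked Precedes W → shape W ≡ canonShape (map val W)
shape-sorted []          _          = refl
shape-sorted (a ∷ [])    _          = refl
shape-sorted (a ∷ b ∷ W) (a≺b ∷ bW) =
  cong₂ (λ d s → (val a , d) ∷ s) (descent-Precedes a b a≺b) (shape-sorted (b ∷ W) bW)

slideValues : WeakComp → List ℕ
slideValues c = map val W[ c ]

slide≡sequences : (c : WeakComp) → slide c ≡ sequences (canonShape (slideValues c))
slide≡sequences c =
  trans (𝔉≡sequences W[ c ])
        (cong sequences (shape-sorted W[ c ] (LinkedP.AllPairs⇒Linked (wordFrom-sorted 1 c))))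

slideValues-decreasing : (c : WeakComp) → AllPairs _≥_ (slideValues c)
slideValues-decreasing c = AllPairsP.map⁺ (AllPairs.map ≥-val (wordFrom-sorted 1 c))
  where
  ≥-val : ∀ {a b} → Precedes a b → val a ≥ val b
  ≥-val (inj₁ lt)       = <⇒≤ lt
  ≥-val (inj₂ (eq , _)) = ≤-reflexive (sym eq)

slideValues-positive : (c : WeakComp) → All (0 <_) (slideValues c)
slideValues-positive c = AllP.map⁺ (wordFrom-≥ 1 c)

map-const : (k : ℕ) (xs : List A) → map (λ _ → k) xs ≡ replicate (length xs) k
map-const k []       = refl
map-const k (x ∷ xs) = cong (k ∷_) (map-const k xs)

values-block : (k x : ℕ) → map val (block k x) ≡ replicate x k
values-block k x = begin
  map val (map (k ,_) (range1 x)) ≡⟨ map-∘ (range1 x) ⟨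
  map (λ _ → k) (range1 x)        ≡⟨ map-const k (range1 x) ⟩
  replicate (length (range1 x)) k ≡⟨ cong (λ n → replicate n k) length-range1 ⟩
  replicate x k                   ∎
  where
  open ≡-Reasoning
  length-range1 = trans (length-map suc (upTo x)) (length-upTo x)

values-wordFrom-∷ʳ : (k : ℕ) (cs : WeakComp) (x : ℕ) →
  map val (wordFrom k (cs ∷ʳ x)) ≡ replicate x (k + length cs) ++ map val (wordFrom k cs)
values-wordFrom-∷ʳ k []       x =
  trans (values-block k x) (sym (trans (++-identityʳ _) (cong (replicate x) (+-identityʳ k))))
values-wordFrom-∷ʳ k (y ∷ cs) x = begin
  map val (wordFrom (suc k) (cs ∷ʳ x) ++ block k y)
    ≡⟨ map-++ val (wordFrom (suc k) (cs ∷ʳ x)) (block k y) ⟩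
  map val (wordFrom (suc k) (cs ∷ʳ x)) ++ map val (block k y)
    ≡⟨ cong (_++ map val (block k y)) (values-wordFrom-∷ʳ (suc k) cs x) ⟩
  (replicate x (suc k + length cs) ++ map val (wordFrom (suc k) cs)) ++ map val (block k y)
    ≡⟨ ++-assoc (replicate x (suc k + length cs)) _ _ ⟩
  replicate x (suc k + length cs) ++ (map val (wordFrom (suc k) cs) ++ map val (block k y))
    ≡⟨ cong₂ _++_ (cong (replicate x) (sym (+-suc k (length cs))))
                  (sym (map-++ val (wordFrom (suc k) cs) (block k y))) ⟩
  replicate x (k + suc (length cs)) ++ map val (wordFrom (suc k) cs ++ block k y) ∎
  where open ≡-Reasoning

splitLeading : ℕ → List ℕ → ℕ × List ℕ
splitLeading k []      = 0 , []
splitLeading k (x ∷ l) = if x ≡ᵇ k then map₁ suc (splitLeading k l) else (0 , x ∷ l)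

splitLeading-++ : (k : ℕ) (l : List ℕ) →
                  l ≡ replicate (proj₁ (splitLeading k l)) k ++ proj₂ (splitLeading k l)
splitLeading-++ k []      = refl
splitLeading-++ k (x ∷ l) with x ≡ᵇ k in eq
... | true  = cong₂ _∷_ (≡ᵇ⇒≡ x k (Equivalence.from T-≡ eq)) (splitLeading-++ k l)
... | false = refl

splitLeading-rest : (n : ℕ) (l : List ℕ) → AllPairs _≥_ l → All (0 <_) l → All (_≤ suc n) l →
  let rest = proj₂ (splitLeading (suc n) l) in
  AllPairs _≥_ rest × All (0 <_) rest × All (_≤ n) rest
splitLeading-rest n []      _           _           _          = [] , [] , []
splitLeading-rest n (x ∷ l) (x≥l ∷ dec) (0<x ∷ pos) (x≤ ∷ bnd) with x ≡ᵇ suc n in eq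
... | true  = splitLeading-rest n l dec pos bnd
... | false = (x≥l ∷ dec) , (0<x ∷ pos) , (x≤n ∷ All.map (λ y≤x → ≤-trans y≤x x≤n) x≥l)
  where
  x≤n : x ≤ n
  x≤n = ≤-pred (≤∧≢⇒< x≤ (λ x≡ → subst T eq (≡⇒≡ᵇ x (suc n) x≡)))

fromValues : ℕ → List ℕ → WeakComp
fromValues zero    l = []
fromValues (suc n) l = fromValues n (proj₂ (splitLeading (suc n) l)) ∷ʳ proj₁ (splitLeading (suc n) l)

length-fromValues : (n : ℕ) (l : List ℕ) → length (fromValues n l) ≡ n
length-fromValues zero    l = refl
length-fromValues (suc n) l =
  trans (length-++ (fromValues n _)) (trans (+-comm _ 1) (cong suc (length-fromValues n _)))

slideValues-fromValues : (n : ℕ) (l : List ℕ) → AllPairs _≥_ l → All (0 <_) l → All (_≤ n) l →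
  slideValues (fromValues n l) ≡ l
slideValues-fromValues zero    []      _ _         _         = refl
slideValues-fromValues zero    (x ∷ l) _ (0<x ∷ _) (x≤0 ∷ _) = ⊥-elim (<⇒≱ 0<x x≤0)
slideValues-fromValues (suc n) l dec pos bnd with splitLeading-rest n l dec pos bnd
... | dec′ , pos′ , bnd′ = begin
  map val (wordFrom 1 (fromValues n rest ∷ʳ copies))
    ≡⟨ values-wordFrom-∷ʳ 1 (fromValues n rest) copies ⟩
  replicate copies (suc (length (fromValues n rest))) ++ slideValues (fromValues n rest)
    ≡⟨ cong₂ (λ k t → replicate copies (suc k) ++ t)
             (length-fromValues n rest) (slideValues-fromValues n rest dec′ pos′ bnd′) ⟩
  replicate copies (suc n) ++ rest
    ≡⟨ splitLeading-++ (suc n) l ⟨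
  l ∎
  where
  open ≡-Reasoning
  copies = proj₁ (splitLeading (suc n) l)
  rest   = proj₂ (splitLeading (suc n) l)

-- Uniqueness

step-canonical : {m n : ℕ} → m ≤ n → T (step (m <ᵇ n) n m)
step-canonical {m} {n} m≤n with m ≤ᵇ n | ≤⇒≤ᵇ m≤n | m <ᵇ n
... | true | _ | true  = _
... | true | _ | false = _

∈-sequences-canonShape : (l : List ℕ) → AllPairs _≥_ l → All (0 <_) l → l ∈ sequences (canonShape l)
∈-sequences-canonShape []              _                 _         = here refl
∈-sequences-canonShape (zero ∷ _)      _                 (() ∷ _)
∈-sequences-canonShape (suc x ∷ [])    _                 _         =
  ∈-concatMap⁺ (prefixed false (sequences [])) (lose (suc∈range1 x) (here refl))
∈-sequences-canonShape (suc x ∷ y ∷ l) ((x≥y ∷ _) ∷ dec) (_ ∷ pos) =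
  ∈-concatMap⁺ (prefixed d (sequences (canonShape (y ∷ l)))) (lose (suc∈range1 x)
    (∈-map⁺ (suc x ∷_) (∈-filter⁺ (T? ∘ headSatisfies (step d (suc x)))
                                   (∈-sequences-canonShape (y ∷ l) dec pos) (step-canonical x≥y))))
  where d = y <ᵇ suc x

sequences-dominated : (s : Shape) → All (λ t → Pointwise _≤_ t (values s)) (sequences s)
sequences-dominated []            = [] ∷ []
sequences-dominated ((v , d) ∷ s) = AllP.concat⁺ (AllP.map⁺ (range1-all v (λ {i} i<v →
  AllP.map⁺ (All.map (i<v ∷_) (AllP.filter⁺ (T? ∘ headSatisfies (step d (suc i))) (sequences-dominated s))))))

Pointwise-≤-sum : {xs ys : List ℕ} → Pointwise _≤_ xs ys → sum xs ≤ sum ys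
Pointwise-≤-sum []       = ≤-refl
Pointwise-≤-sum (p ∷ ps) = +-mono-≤ p (Pointwise-≤-sum ps)

Pointwise-≤-sum-≥ : {xs ys : List ℕ} → Pointwise _≤_ xs ys → sum ys ≤ sum xs → xs ≡ ys
Pointwise-≤-sum-≥                   []         _ = refl
Pointwise-≤-sum-≥ {x ∷ xs} {y ∷ ys} (x≤y ∷ ps) h with m≤n⇒m<n∨m≡n x≤y
... | inj₁ x<y  = ⊥-elim (<⇒≱ (+-mono-<-≤ x<y (Pointwise-≤-sum ps)) h)
... | inj₂ refl = cong (x ∷_) (Pointwise-≤-sum-≥ ps (+-cancelˡ-≤ x _ _ h))

-- slideValues c is a term of slide c dominating all its terms entrywise.
slide-dominated : (c c′ : WeakComp) → slide c ≈P slide c′ →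
  Σ (List ℕ) λ t → slideValues c ↭ t × Pointwise _≤_ t (slideValues c′)
slide-dominated c c′ h with find (∈-resp-≈P h (Any.map ↭-reflexive term))
  where
  term : slideValues c ∈ slide c
  term = subst (slideValues c ∈_) (sym (slide≡sequences c))
               (∈-sequences-canonShape (slideValues c) (slideValues-decreasing c) (slideValues-positive c))
... | t , t∈ , c↭t =
  t , c↭t , subst (Pointwise _≤_ t) (values-canonShape (slideValues c′)) (All.lookup dominated t∈)
  where
  dominated : All (λ t → Pointwise _≤_ t (values (canonShape (slideValues c′)))) (slide c′)
  dominated = subst (All _) (sym (slide≡sequences c′)) (sequences-dominated (canonShape (slideValues c′)))

slideValues-↭ : (c c′ : WeakComp) → slide c ≈P slide c′ → slideValues c ↭ slideValues c′
slideValues-↭ c c′ h with slide-dominated c c′ h | slide-dominated c′ c (≈P-sym h)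
... | t , c↭t , t≤c′ | _ , c′↭t′ , t′≤c = subst (slideValues c ↭_) t≡c′ c↭t
  where
  sum-c′≤sum-c : sum (slideValues c′) ≤ sum (slideValues c)
  sum-c′≤sum-c = subst (_≤ sum (slideValues c)) (sym (sum-↭ c′↭t′)) (Pointwise-≤-sum t′≤c)
  t≡c′ : t ≡ slideValues c′
  t≡c′ = Pointwise-≤-sum-≥ t≤c′ (subst (sum (slideValues c′) ≤_) (sum-↭ c↭t) sum-c′≤sum-c)

count : ℕ → List ℕ → ℕ
count i = length ∘ filter (_≟ i)

count-↭ : (i : ℕ) {xs ys : List ℕ} → xs ↭ ys → count i xs ≡ count i ys
count-↭ i p = ↭-length (filter-↭ (_≟ i) p)

count-++ : (i : ℕ) (xs ys : List ℕ) → count i (xs ++ ys) ≡ count i xs + count i ys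
count-++ i xs ys = trans (cong length (filter-++ (_≟ i) xs ys)) (length-++ (filter (_≟ i) xs))

count-replicate-≡ : (k x : ℕ) → count k (replicate x k) ≡ x
count-replicate-≡ k x =
  trans (cong length (filter-all (_≟ k) (AllP.replicate⁺ x refl))) (length-replicate x)

count-replicate-≢ : {i k : ℕ} (x : ℕ) → k ≢ i → count i (replicate x k) ≡ 0
count-replicate-≢ {i} x k≢i = cong length (filter-none (_≟ i) (AllP.replicate⁺ x k≢i))

count-wordFrom-< : {i k : ℕ} → i < k → (c : WeakComp) → count i (map val (wordFrom k c)) ≡ 0
count-wordFrom-< {i} {k} i<k c = cong length (filter-none (_≟ i) (AllP.map⁺ (All.map v≢i (wordFrom-≥ k c))))
  where
  v≢i : ∀ {v} → k ≤ v → v ≢ i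
  v≢i k≤v v≡i = <-irrefl (sym v≡i) (<-≤-trans i<k k≤v)

count-wordFrom : (k d : ℕ) (c : WeakComp) → count (k + d) (map val (wordFrom k c)) ≡ c at suc d
count-wordFrom k d []       = refl
count-wordFrom k d (x ∷ cs)
  rewrite map-++ val (wordFrom (suc k) cs) (block k x) | values-block k x
        | count-++ (k + d) (map val (wordFrom (suc k) cs)) (replicate x k)
  with d
... | zero  rewrite +-identityʳ k | count-wordFrom-< (n<1+n k) cs = count-replicate-≡ k x
... | suc d rewrite +-suc k d | count-replicate-≢ {suc k + d} x (λ k≡ → <-irrefl k≡ (s≤s (m≤m+n k d)))
  = trans (+-identityʳ _) (count-wordFrom (suc k) d cs)

slide-injective : (c c′ : WeakComp) → slide c ≈P slide c′ → c ≈C c′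
slide-injective c c′ h zero    = refl
slide-injective c c′ h (suc d) = begin
  c at suc d                   ≡⟨ count-wordFrom 1 d c ⟨
  count (suc d) (slideValues c)  ≡⟨ count-↭ (suc d) (slideValues-↭ c c′ h) ⟩
  count (suc d) (slideValues c′) ≡⟨ count-wordFrom 1 d c′ ⟩
  c′ at suc d                  ∎
  where open ≡-Reasoning

headValue : Word → ℕ
headValue []      = 0
headValue (a ∷ _) = val a

𝔉≡sequences-normalise : (W : Word) → 𝔉 W ≡ sequences (normalise (headValue W) (shape W))
𝔉≡sequences-normalise W =
  trans (𝔉≡sequences W)
        (trans (cong sequences (sym (capHead-headValue W))) (sequences-capHead (headValue W) (shape W)))
  where
  capHead-headValue : (W : Word) → capHead (headValue W) (shape W) ≡ shape W
  capHead-headValue []      = refl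
  capHead-headValue (a ∷ W) = cong (λ v → (v , descent a W) ∷ shape W) (⊓-idem (val a))

normalise-slideValues : (m : ℕ) (W : Word) → All ((0 <_) ∘ proj₁) (normalise m (shape W)) →
  let s = normalise m (shape W) in slideValues (fromValues m (values s)) ≡ values s
normalise-slideValues m W pos = slideValues-fromValues m (values (normalise m (shape W)))
  (LinkedP.Linked⇒AllPairs (λ x≥y y≥z → ≤-trans y≥z x≥y) (normalise-decreasing m (shape W)))
  (AllP.map⁺ pos) (normalise-bounded m (shape W))

proposition3p9 : (W : Word) → All PositiveLetter W → Unique W →
    (𝔉 W ≈P 0P) ⊎
    (Σ WeakComp (λ c → (𝔉 W ≈P slide c) × ((c' : WeakComp) → 𝔉 W ≈P slide c' → c ≈C c')))
proposition3p9 W _ _ with positive-or-vanishing (normalise (headValue W) (shape W))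
... | inj₂ vanishing =
  inj₁ (≈P-reflexive (trans (𝔉≡sequences-normalise W) (sequences-vanish _ vanishing)))
... | inj₁ pos =
  inj₂ (c , ≈P-reflexive 𝔉≡slide ,
        λ c′ h → slide-injective c c′ (≈P-trans (≈P-sym (≈P-reflexive 𝔉≡slide)) h))
  where
  m = headValue W
  s = normalise m (shape W)
  c = fromValues m (values s)
  𝔉≡slide : 𝔉 W ≡ slide c
  𝔉≡slide = begin
    𝔉 W                                    ≡⟨ 𝔉≡sequences-normalise W ⟩
    sequences s                            ≡⟨ cong sequences (normalise-canonShape m W pos) ⟩
    sequences (canonShape (values s))      ≡⟨ cong (sequences ∘ canonShape) (normalise-slideValues m W pos) ⟨
    sequences (canonShape (slideValues c)) ≡⟨ slide≡sequences c ⟨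
    slide c                                ∎
    where open ≡-Reasoning
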